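{- For $m\ge3$ and $n\geq 1$, the zero-free chromatic polynomial of $B_1(m,n)=(B(m,n),\{uu_1^1\})$ is $\chi^b_{B_1(m,n)}(\lambda)=\lambda\gamma_m^{n-1}\gamma_{m+1}$, where $\gamma_j=\frac{(\lambda-1)^{j-1}-(-1)^{j-1}}{\lambda}$.
   Context: The book graph $B(m,n)$ has vertices $\{u,v\}\cup\{u_j^i:1\le i\le n,1\le j\le m-2\}$ and consists of the $n$ cycles $uu_1^i\cdots u_{m-2}^ivu$ sharing the edge $uv$; in $(B(m,n),\{uu_1^1\})$ the edge $uu_1^1$ is the only negative edge. A zero-free coloring in $2k$ signed colors is a map $c:V\to\{ -k,\ldots,-1,1,\ldots,k\}$, proper if $c(x)\ne\sigma(e)c(y)$ for every edge $e=xy$; the zero-free chromatic polynomial is the polynomial whose value at $\lambda=2k$ counts proper zero-free colorings. -}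

module Defs where

open import Level using (0ℓ)
open import Data.Nat as ℕ using (ℕ; zero; suc)
open import Data.Fin using (Fin; toℕ)
open import Data.Sign using (Sign) renaming (+ to pos; - to neg)
open import Data.Integer as ℤ using (ℤ; _◃_)
open import Data.Product using (Σ; proj₁; _×_; _,_)
open import Relation.Nullary using (¬_)
open import Relation.Binary.PropositionalEquality using (_≡_)
open import Relation.Binary.Bundles using (Setoid)

-- Signed colours {-k,…,-1,1,…,k}: a sign together with a magnitude
-- (toℕ i + 1) ∈ {1,…,k}.
SColor : ℕ → Set
SColor k = Sign × Fin k

colorValue : ∀ {k} → SColor k → ℤ
colorValue (s , i) = s ◃ suc (toℕ i)

act : Sign → ℤ → ℤ
act pos x = x
act neg x = ℤ.- x

-- Vertices of the book graph B(m,n), with p = m - 2 internal vertices per page: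
-- u, v, and w i j = u_{j+1}^{i+1} (0-based indices i : Fin n, j : Fin p).
data BVertex (n p : ℕ) : Set where
  u v : BVertex n p
  w   : Fin n → Fin p → BVertex n p

data BEdge (n p : ℕ) : BVertex n p → BVertex n p → Sign → Set where
  e-uv    : BEdge n p u v pos
  e-first : (i : Fin n) (j : Fin p) → toℕ j ≡ 0 →
            ¬ (toℕ i ≡ 0) → BEdge n p u (w i j) pos
  e-neg   : (i : Fin n) (j : Fin p) → toℕ j ≡ 0 →
            toℕ i ≡ 0 → BEdge n p u (w i j) neg
  e-mid   : (i : Fin n) (j j′ : Fin p) → toℕ j′ ≡ suc (toℕ j) →
            BEdge n p (w i j) (w i j′) pos
  e-last  : (i : Fin n) (j : Fin p) → suc (toℕ j) ≡ p →
            BEdge n p (w i j) v pos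

Coloring : ℕ → ℕ → ℕ → Set
Coloring k n p = BVertex n p → SColor k

Proper : ∀ {k n p} → Coloring k n p → Set
Proper {k} {n} {p} c =
  ∀ (x y : BVertex n p) (s : Sign) → BEdge n p x y s →
    ¬ (colorValue (c x) ≡ act s (colorValue (c y)))

ProperColorings : (k m n : ℕ) → Setoid 0ℓ 0ℓ
ProperColorings k m n = record
  { Carrier       = Σ (Coloring k n (m ℕ.∸ 2)) Proper
  ; _≈_           = λ c d → ∀ x → proj₁ c x ≡ proj₁ d x
  ; isEquivalence = record
      { refl  = λ x → Relation.Binary.PropositionalEquality.refl
      ; sym   = λ e x → Relation.Binary.PropositionalEquality.sym (e x)
      ; trans = λ e f x → Relation.Binary.PropositionalEquality.trans (e x) (f x)
      }
  }

-- Fix the colours a = c(u) and b = c(v), a ≠ b. Each page u, u₁ⁱ, …, u_{m-2}ⁱ, v is then a proper colouring of a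
-- path with prescribed end colours, i.e. a walk of length m - 1 in the complete graph on the λ = 2k colours: from a
-- to b on the positive pages, and from -a to b on the first page, whose negative edge uu₁¹ forbids c(u₁¹) = -a
-- instead of c(u₁¹) = a. Between distinct ends there are γ_m such walks; between equal ends there are E of them,
-- with E + (λ - 2)γ_m = γ_{m+1}. Since -a ≠ a (no colour 0), summing over b ≠ a gives E·γ_m^{n-1} for b = -a and
-- γ_m^n for the other λ - 2 values, so N = λ γ_{m+1} γ_m^{n-1}. The bijection with Fin N decodes an index along
-- exactly these sums and products.

module Submission where

open import Defs
open import Data.Nat as ℕ using (ℕ; zero; suc; _+_; _*_; _∸_; _≤_; pred; s≤s; z≤n)
import Data.Nat.Properties as ℕ
open import Data.Nat.Properties using (+-0-commutativeMonoid; *-identityˡ; *-distribʳ-+; *-assoc)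
open import Data.Fin
  using (Fin; zero; suc; toℕ; punchIn; punchOut; splitAt; join; _↑ˡ_; _↑ʳ_; combine; remQuot; finToFun; funToFin; _≟_)
open import Data.Fin.Properties
  using (punchIn-injective; punchInᵢ≢i; punchIn-punchOut; splitAt-↑ˡ; splitAt-↑ʳ; join-splitAt;
         remQuot-combine; combine-remQuot; finToFun-funToFin; funToFin-finToFin; toℕ-injective)
open import Data.Vec.Functional using (_∷_)
open import Data.Sign as Sign using () renaming (+ to pos; - to neg)
open import Data.Integer as ℤ using (ℤ; +_; -_; _-_; _^_; -1ℤ; 1ℤ) renaming (_*_ to _*ℤ_; _+_ to _+ℤ_)
import Data.Integer.Properties as ℤ
open import Data.Integer.Tactic.RingSolver using (solve-∀)
open import Data.Product as Product using (Σ; _×_; _,_; proj₁; proj₂; uncurry)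
open import Data.Product.Properties using (Σ-≡,≡←≡)
open import Data.Sum using (inj₁; inj₂; [_,_]′)
open import Data.Empty using (⊥-elim)
open import Relation.Nullary using (yes; no)
open import Relation.Binary.Bundles using (Setoid)
open import Relation.Binary.PropositionalEquality
  using (_≡_; _≢_; _≗_; refl; sym; trans; cong; cong₂; setoid; ≢-sym; module ≡-Reasoning)
open import Function using (_∘_; id)
open import Function.Bundles using (Inverse)
open import Algebra.Properties.CommutativeMonoid.Sum +-0-commutativeMonoid using (sum; sum-remove; sum-cong-≗)

module _ {c ℓ} (S : Setoid c ℓ) {N : ℕ} where
  open Setoid S using (Carrier; _≈_) renaming (sym to ≈-sym; trans to ≈-trans)

  injective-section⇒Inverse : (from : Fin N → Carrier) (to : Carrier → Fin N) →
    (∀ x → from (to x) ≈ x) → (∀ i j → from i ≈ from j → i ≡ j) →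
    Inverse S (setoid (Fin N))
  injective-section⇒Inverse from to from∘to from-injective = record
    { to        = to
    ; from      = from
    ; to-cong   = λ {x} {y} x≈y → from-injective (to x) (to y)
                    (≈-trans (from∘to x) (≈-trans x≈y (≈-sym (from∘to y))))
    ; from-cong = λ { refl → Setoid.refl S }
    ; inverse   = (λ {i} {x} x≈from-i → from-injective (to x) i (≈-trans (from∘to x) x≈from-i))
                , (λ { {x} refl → from∘to x })
    }

sum-const : ∀ {n} {f : Fin n → ℕ} {d} → (∀ j → f j ≡ d) → sum f ≡ n * d
sum-const {zero}  f≡d = refl
sum-const {suc n} f≡d = cong₂ _+_ (f≡d zero) (sum-const (f≡d ∘ suc))

sum-const-except : ∀ {n} {f : Fin n → ℕ} (i : Fin n) {e d} →
  f i ≡ e → (∀ j → j ≢ i → f j ≡ d) → sum f ≡ e + pred n * d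
sum-const-except {suc n} {f} i {e} {d} fi≡e f≡d = begin
  sum f                      ≡⟨ sum-remove {i = i} f ⟩
  f i + sum (f ∘ punchIn i)  ≡⟨ cong₂ _+_ fi≡e (sum-const λ j → f≡d (punchIn i j) (punchInᵢ≢i i j)) ⟩
  e + n * d                  ∎
  where open ≡-Reasoning

splitΣ : ∀ {n} (f : Fin n → ℕ) → Fin (sum f) → Σ (Fin n) (Fin ∘ f)
splitΣ {suc n} f i = [ (zero ,_) , Product.map suc id ∘ splitΣ (f ∘ suc) ]′ (splitAt (f zero) i)

joinΣ : ∀ {n} (f : Fin n → ℕ) → Σ (Fin n) (Fin ∘ f) → Fin (sum f)
joinΣ {suc n} f (zero  , t) = t ↑ˡ sum (f ∘ suc)
joinΣ {suc n} f (suc x , t) = f zero ↑ʳ joinΣ (f ∘ suc) (x , t)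

splitΣ-joinΣ : ∀ {n} (f : Fin n → ℕ) y → splitΣ f (joinΣ f y) ≡ y
splitΣ-joinΣ {suc n} f (zero , t)
  rewrite splitAt-↑ˡ (f zero) t (sum (f ∘ suc)) = refl
splitΣ-joinΣ {suc n} f (suc x , t)
  rewrite splitAt-↑ʳ (f zero) (sum (f ∘ suc)) (joinΣ (f ∘ suc) (x , t))
        | splitΣ-joinΣ (f ∘ suc) (x , t) = refl

joinΣ-splitΣ : ∀ {n} (f : Fin n → ℕ) i → joinΣ f (splitΣ f i) ≡ i
joinΣ-splitΣ {suc n} f i = trans (joinΣ-on-splitAt (splitAt (f zero) i)) (join-splitAt (f zero) _ i)
  where
  joinΣ-on-splitAt : ∀ y → joinΣ f ([ (zero ,_) , Product.map suc id ∘ splitΣ (f ∘ suc) ]′ y)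
                           ≡ join (f zero) (sum (f ∘ suc)) y
  joinΣ-on-splitAt (inj₁ t) = refl
  joinΣ-on-splitAt (inj₂ r) = cong (f zero ↑ʳ_) (joinΣ-splitΣ (f ∘ suc) r)

splitΣ-injective : ∀ {n} (f : Fin n → ℕ) {i j} → splitΣ f i ≡ splitΣ f j → i ≡ j
splitΣ-injective f {i} {j} eq =
  trans (sym (joinΣ-splitΣ f i)) (trans (cong (joinΣ f) eq) (joinΣ-splitΣ f j))

funToFin-cong : ∀ {m n} {f g : Fin m → Fin n} → f ≗ g → funToFin f ≡ funToFin g
funToFin-cong {zero}  f≗g = refl
funToFin-cong {suc m} f≗g = cong₂ combine (f≗g zero) (funToFin-cong (f≗g ∘ suc))

finToFun-injective : ∀ {m n} {i j : Fin (m ℕ.^ n)} → finToFun {m} {n} i ≗ finToFun j → i ≡ j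
finToFun-injective {m} {n} {i} {j} same =
  trans (sym (funToFin-finToFin {n} {m} i)) (trans (funToFin-cong same) (funToFin-finToFin {n} {m} j))

distinct : ∀ {s} → Fin s → Fin s → ℕ
distinct a b with a ≟ b
... | yes _ = 0
... | no  _ = 1

distinct-refl : ∀ {s} (a : Fin s) → distinct a a ≡ 0
distinct-refl a with a ≟ a
... | yes _   = refl
... | no  a≢a = ⊥-elim (a≢a refl)

distinct-≢ : ∀ {s} {a b : Fin s} → a ≢ b → distinct a b ≡ 1
distinct-≢ {a = a} {b} a≢b with a ≟ b
... | yes a≡b = ⊥-elim (a≢b a≡b)
... | no  _   = refl

distinct⇒≢ : ∀ {s} {a b : Fin s} → Fin (distinct a b) → a ≢ b
distinct⇒≢ {a = a} {b} d with a ≟ b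
distinct⇒≢ () | yes _
...           | no a≢b = a≢b

≢⇒distinct : ∀ {s} {a b : Fin s} → a ≢ b → Fin (distinct a b)
≢⇒distinct {a = a} {b} a≢b with a ≟ b
... | yes a≡b = ⊥-elim (a≢b a≡b)
... | no  _   = zero

distinct-unique : ∀ {s} {a b : Fin s} (d d′ : Fin (distinct a b)) → d ≡ d′
distinct-unique {a = a} {b} d d′ with a ≟ b
distinct-unique zero zero | no _ = refl

-- Summing over all x with an indicator, rather than over punchIn a, keeps x itself as the index
-- of its summand, so that decoding an index of the sum needs no transport along punchIn-punchOut.
sumOver≢ : ∀ {s} → Fin s → (Fin s → ℕ) → ℕ
sumOver≢ a T = sum (λ x → distinct a x * T x)

sumOver≢-punchIn : ∀ {L} (a : Fin (suc L)) (T : Fin (suc L) → ℕ) → sumOver≢ a T ≡ sum (T ∘ punchIn a)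
sumOver≢-punchIn a T = begin
  sumOver≢ a T
    ≡⟨ sum-remove {i = a} (λ x → distinct a x * T x) ⟩
  distinct a a * T a + sum (λ j → distinct a (punchIn a j) * T (punchIn a j))
    ≡⟨ cong₂ _+_ (cong (_* T a) (distinct-refl a)) (sum-cong-≗ λ j →
         trans (cong (_* T (punchIn a j)) (distinct-≢ (≢-sym (punchInᵢ≢i a j)))) (*-identityˡ _)) ⟩
  sum (T ∘ punchIn a)
    ∎
  where open ≡-Reasoning

sumOver≢-const : ∀ {L} {a : Fin (suc L)} {T d} → (∀ x → a ≢ x → T x ≡ d) → sumOver≢ a T ≡ L * d
sumOver≢-const {a = a} {T} T≡d =
  trans (sumOver≢-punchIn a T) (sum-const λ j → T≡d _ (≢-sym (punchInᵢ≢i a j)))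

sumOver≢-except : ∀ {L} {a c : Fin (suc L)} {T e d} → a ≢ c → T c ≡ e →
  (∀ x → a ≢ x → x ≢ c → T x ≡ d) → sumOver≢ a T ≡ e + pred L * d
sumOver≢-except {a = a} {c} {T} a≢c Tc≡e T≡d =
  trans (sumOver≢-punchIn a T)
        (sum-const-except (punchOut a≢c) (trans (cong T (punchIn-punchOut a≢c)) Tc≡e) λ j j≢ →
          T≡d _ (≢-sym (punchInᵢ≢i a j)) λ eq →
            j≢ (punchIn-injective a j _ (trans eq (sym (punchIn-punchOut a≢c)))))

module _ {s} (a : Fin s) (T : Fin s → ℕ) where

  indicated : Fin s → ℕ
  indicated x = distinct a x * T x

  dropIndicator : Σ (Fin s) (Fin ∘ indicated) → Σ (Fin s) (Fin ∘ T)
  dropIndicator (x , t) = x , proj₂ (remQuot {distinct a x} (T x) t)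

  dropIndicator-injective : ∀ y y′ → dropIndicator y ≡ dropIndicator y′ → y ≡ y′
  dropIndicator-injective (x , t) (x′ , t′) eq with Σ-≡,≡←≡ eq
  ... | refl , t≡t′ = cong (x ,_) (begin
    t                          ≡⟨ combine-remQuot {distinct a x} (T x) t ⟨
    uncurry combine (split t)  ≡⟨ cong₂ combine (distinct-unique {a = a} {x} _ _) t≡t′ ⟩
    uncurry combine (split t′) ≡⟨ combine-remQuot {distinct a x} (T x) t′ ⟩
    t′                         ∎)
    where
    open ≡-Reasoning
    split : Fin (indicated x) → Fin (distinct a x) × Fin (T x)
    split = remQuot (T x)

  dropIndicator-≢ : ∀ y → a ≢ proj₁ (dropIndicator y)
  dropIndicator-≢ (x , t) = distinct⇒≢ (proj₁ (remQuot {distinct a x} (T x) t))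

  split≢ : Fin (sumOver≢ a T) → Σ (Fin s) (Fin ∘ T)
  split≢ = dropIndicator ∘ splitΣ indicated

  join≢ : (x : Fin s) → a ≢ x → Fin (T x) → Fin (sumOver≢ a T)
  join≢ x a≢x t = joinΣ indicated (x , combine (≢⇒distinct a≢x) t)

  split≢-≢ : ∀ i → a ≢ proj₁ (split≢ i)
  split≢-≢ i = dropIndicator-≢ (splitΣ indicated i)

  split≢-join≢ : ∀ x a≢x t → split≢ (join≢ x a≢x t) ≡ (x , t)
  split≢-join≢ x a≢x t = trans (cong dropIndicator (splitΣ-joinΣ indicated _))
                               (cong (λ r → x , proj₂ r) (remQuot-combine {k = T x} (≢⇒distinct a≢x) t))

  split≢-injective : ∀ {i j} → split≢ i ≡ split≢ j → i ≡ j
  split≢-injective eq = splitΣ-injective indicated (dropIndicator-injective _ _ eq)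

-- walks q a b counts the colourings x₁ … x_q in Fin s with a ≠ x₁ ≠ ⋯ ≠ x_q ≠ b,
-- i.e. the walks of length q + 1 from a to b in the complete graph on Fin s.
walks : ∀ {s} → ℕ → Fin s → Fin s → ℕ
walks zero    a b = distinct a b
walks (suc q) a b = sumOver≢ a (λ x → walks q x b)

IsWalk : ∀ {s} (q : ℕ) → Fin s → Fin s → (Fin q → Fin s) → Set
IsWalk zero    a b f = a ≢ b
IsWalk (suc q) a b f = a ≢ f zero × IsWalk q (f zero) b (f ∘ suc)

IsWalk-adjacent : ∀ {s q} {a b : Fin s} f → IsWalk q a b f →
  ∀ j j′ → toℕ j′ ≡ suc (toℕ j) → f j ≢ f j′
IsWalk-adjacent {q = suc (suc q)} f (_ , f₀≢f₁ , _) zero (suc zero) _ = f₀≢f₁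
IsWalk-adjacent {q = suc q} f (_ , walk) (suc j) (suc j′) eq =
  IsWalk-adjacent (f ∘ suc) walk j j′ (ℕ.suc-injective eq)
IsWalk-adjacent {q = suc q} f _ zero zero ()
IsWalk-adjacent {q = suc (suc q)} f _ zero (suc (suc j′)) ()

IsWalk-last : ∀ {s q} {a b : Fin s} f → IsWalk (suc q) a b f → ∀ j → suc (toℕ j) ≡ suc q → f j ≢ b
IsWalk-last {q = zero}  f (_ , f₀≢b) zero    _  = f₀≢b
IsWalk-last {q = suc q} f (_ , walk) (suc j) eq = IsWalk-last (f ∘ suc) walk j (ℕ.suc-injective eq)

edges⇒IsWalk : ∀ {s q} {a b : Fin s} {f : Fin (suc q) → Fin s} → a ≢ f zero →
  (∀ j j′ → toℕ j′ ≡ suc (toℕ j) → f j ≢ f j′) → (∀ j → suc (toℕ j) ≡ suc q → f j ≢ b) →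
  IsWalk (suc q) a b f
edges⇒IsWalk {q = zero}  a≢f₀ adjacent last = a≢f₀ , last zero refl
edges⇒IsWalk {q = suc q} a≢f₀ adjacent last =
  a≢f₀ , edges⇒IsWalk (adjacent zero (suc zero) refl)
                      (λ j j′ eq → adjacent (suc j) (suc j′) (cong suc eq))
                      (λ j eq → last (suc j) (cong suc eq))

decodeWalk : ∀ {s} q (a b : Fin s) → Fin (walks q a b) → Fin q → Fin s
consWalk : ∀ {s} q (b : Fin s) → Σ (Fin s) (λ x → Fin (walks q x b)) → Fin (suc q) → Fin s
decodeWalk zero    a b _ ()
decodeWalk (suc q) a b = consWalk q b ∘ split≢ a (λ x → walks q x b)
consWalk q b (x , t) = x ∷ decodeWalk q x b t

decodeWalk-isWalk : ∀ {s} q (a b : Fin s) i → IsWalk q a b (decodeWalk q a b i)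
decodeWalk-isWalk zero    a b i = distinct⇒≢ i
decodeWalk-isWalk (suc q) a b i =
  split≢-≢ a _ i , decodeWalk-isWalk q _ b (proj₂ (split≢ a (λ x → walks q x b) i))

decodeWalk-injective : ∀ {s} q {a b : Fin s} i j → decodeWalk q a b i ≗ decodeWalk q a b j → i ≡ j
decodeWalk-injective zero    i j _ = distinct-unique i j
decodeWalk-injective {s} (suc q) {a} {b} i j same =
  split≢-injective a _ (consWalk-injective (split≢ a _ i) (split≢ a _ j) same)
  where
  consWalk-injective : ∀ y y′ → consWalk q b y ≗ consWalk q b y′ → y ≡ y′
  consWalk-injective (x , t) (x′ , t′) same with same zero
  ... | refl = cong (x ,_) (decodeWalk-injective q t t′ (same ∘ suc))

encodeWalk : ∀ {s} q {a b : Fin s} {f} → IsWalk q a b f → Fin (walks q a b)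
encodeWalk zero    a≢b = ≢⇒distinct a≢b
encodeWalk (suc q) {a} {b} {f} (a≢f₀ , walk) = join≢ a _ (f zero) a≢f₀ (encodeWalk q walk)

decodeWalk-encodeWalk : ∀ {s} q {a b : Fin s} {f} (walk : IsWalk q a b f) →
  decodeWalk q a b (encodeWalk q walk) ≗ f
decodeWalk-encodeWalk (suc q) {a} {b} {f} (a≢f₀ , walk) j =
  trans (cong (λ y → consWalk q b y j) (split≢-join≢ a _ (f zero) a≢f₀ (encodeWalk q walk)))
        (consWalk-encodeWalk j)
  where
  consWalk-encodeWalk : consWalk q b (f zero , encodeWalk q walk) ≗ f
  consWalk-encodeWalk zero    = refl
  consWalk-encodeWalk (suc j) = decodeWalk-encodeWalk q walk j

openWalks closedWalks : ℕ → ℕ → ℕ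
openWalks   L zero    = 1
openWalks   L (suc q) = closedWalks L q + pred L * openWalks L q
closedWalks L zero    = 0
closedWalks L (suc q) = L * openWalks L q

walks-≢ : ∀ {L} q {a b : Fin (suc L)} → a ≢ b → walks q a b ≡ openWalks L q
walks-≡ : ∀ {L} q (a : Fin (suc L)) → walks q a a ≡ closedWalks L q
walks-≢ zero    a≢b = distinct-≢ a≢b
walks-≢ (suc q) {b = b} a≢b = sumOver≢-except a≢b (walks-≡ q b) λ x _ x≢b → walks-≢ q x≢b
walks-≡ zero    a = distinct-refl a
walks-≡ (suc q) a = sumOver≢-const {a = a} λ x a≢x → walks-≢ q (≢-sym a≢x)

module SignedColors (k : ℕ) where

  opposite : SColor k → SColor k
  opposite (s , i) = Sign.opposite s , i

  opposite-irreflexive : (c : SColor k) → opposite c ≢ c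
  opposite-irreflexive (pos , i) ()
  opposite-irreflexive (neg , i) ()

  colorValue-opposite : (c : SColor k) → colorValue (opposite c) ≡ - colorValue c
  colorValue-opposite (pos , i) = refl
  colorValue-opposite (neg , i) = refl

  colorValue-injective : ∀ {c d : SColor k} → colorValue c ≡ colorValue d → c ≡ d
  colorValue-injective {pos , i} {pos , j} eq = cong (pos ,_) (toℕ-injective (ℕ.suc-injective (ℤ.+-injective eq)))
  colorValue-injective {neg , i} {neg , j} eq = cong (neg ,_) (toℕ-injective (ℤ.-[1+-injective eq))
  colorValue-injective {pos , i} {neg , j} ()
  colorValue-injective {neg , i} {pos , j} ()

  opposite≡⇒colorValue≡- : ∀ {c d : SColor k} → opposite c ≡ d → colorValue c ≡ - colorValue d
  opposite≡⇒colorValue≡- {c} refl = trans (sym (ℤ.neg-involutive _)) (cong -_ (sym (colorValue-opposite c)))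

  colorValue≡-⇒opposite≡ : ∀ {c d : SColor k} → colorValue c ≡ - colorValue d → opposite c ≡ d
  colorValue≡-⇒opposite≡ {c} eq =
    colorValue-injective (trans (colorValue-opposite c) (trans (cong -_ eq) (ℤ.neg-involutive _)))

  colorIndex : SColor k → Fin (k + k)
  colorIndex (pos , i) = i ↑ˡ k
  colorIndex (neg , i) = k ↑ʳ i

  indexColor : Fin (k + k) → SColor k
  indexColor x = [ (pos ,_) , (neg ,_) ]′ (splitAt k x)

  indexColor-colorIndex : (c : SColor k) → indexColor (colorIndex c) ≡ c
  indexColor-colorIndex (pos , i) = cong [ (pos ,_) , (neg ,_) ]′ (splitAt-↑ˡ k i k)
  indexColor-colorIndex (neg , i) = cong [ (pos ,_) , (neg ,_) ]′ (splitAt-↑ʳ k k i)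

  colorIndex-indexColor : (x : Fin (k + k)) → colorIndex (indexColor x) ≡ x
  colorIndex-indexColor x = trans (colorIndex-on-splitAt (splitAt k x)) (join-splitAt k k x)
    where
    colorIndex-on-splitAt : ∀ y → colorIndex ([ (pos ,_) , (neg ,_) ]′ y) ≡ join k k y
    colorIndex-on-splitAt (inj₁ i) = refl
    colorIndex-on-splitAt (inj₂ i) = refl

  colorIndex-injective : ∀ {c d : SColor k} → colorIndex c ≡ colorIndex d → c ≡ d
  colorIndex-injective {c} {d} eq =
    trans (sym (indexColor-colorIndex c)) (trans (cong indexColor eq) (indexColor-colorIndex d))

  indexColor-injective : ∀ {x y : Fin (k + k)} → indexColor x ≡ indexColor y → x ≡ y
  indexColor-injective {x} {y} eq =
    trans (sym (colorIndex-indexColor x)) (trans (cong colorIndex eq) (colorIndex-indexColor y))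

  oppositeIndex : Fin (k + k) → Fin (k + k)
  oppositeIndex = colorIndex ∘ opposite ∘ indexColor

  oppositeIndex-colorIndex : (c : SColor k) → oppositeIndex (colorIndex c) ≡ colorIndex (opposite c)
  oppositeIndex-colorIndex c = cong (colorIndex ∘ opposite) (indexColor-colorIndex c)

  oppositeIndex-irreflexive : (x : Fin (k + k)) → oppositeIndex x ≢ x
  oppositeIndex-irreflexive x eq = opposite-irreflexive (indexColor x)
    (trans (sym (indexColor-colorIndex _)) (cong indexColor eq))

module BookColorings {s} (flip : Fin s → Fin s) (n′ p : ℕ) where

  Vertex : Set
  Vertex = BVertex (suc n′) p

  record PagesAreWalks (c : Vertex → Fin s) : Set where
    field
      ends-distinct : c u ≢ c v
      first-page    : IsWalk p (flip (c u)) (c v) (c ∘ w zero)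
      other-pages   : ∀ i → IsWalk p (c u) (c v) (c ∘ w (suc i))

  pagesCount : Fin s → Fin s → ℕ
  pagesCount a b = walks p (flip a) b * walks p a b ℕ.^ n′

  countFrom : Fin s → ℕ
  countFrom a = sumOver≢ a (pagesCount a)

  count : ℕ
  count = sum countFrom

  splitPages : ∀ {a b} → Fin (pagesCount a b) → Fin (walks p (flip a) b) × Fin (walks p a b ℕ.^ n′)
  splitPages {a} {b} = remQuot {walks p (flip a) b} (walks p a b ℕ.^ n′)

  decodePages : (a b : Fin s) → Fin (pagesCount a b) → Vertex → Fin s
  decodePages a b t u             = a
  decodePages a b t v             = b
  decodePages a b t (w zero j)    = decodeWalk p (flip a) b (proj₁ (splitPages t)) j
  decodePages a b t (w (suc i) j) = decodeWalk p a b (finToFun (proj₂ (splitPages t)) i) j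

  decodeFrom : (a : Fin s) → Σ (Fin s) (Fin ∘ pagesCount a) → Vertex → Fin s
  decodeFrom a (b , t) = decodePages a b t

  decodeΣ : Σ (Fin s) (Fin ∘ countFrom) → Vertex → Fin s
  decodeΣ (a , r) = decodeFrom a (split≢ a (pagesCount a) r)

  decode : Fin count → Vertex → Fin s
  decode = decodeΣ ∘ splitΣ countFrom

  decodeΣ-pagesAreWalks : ∀ y → PagesAreWalks (decodeΣ y)
  decodeΣ-pagesAreWalks (a , r) = record
    { ends-distinct = split≢-≢ a (pagesCount a) r
    ; first-page    = decodeWalk-isWalk p _ _ _
    ; other-pages   = λ i → decodeWalk-isWalk p _ _ _
    }

  decode-pagesAreWalks : ∀ i → PagesAreWalks (decode i)
  decode-pagesAreWalks i = decodeΣ-pagesAreWalks (splitΣ countFrom i)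

  decodePages-injective : ∀ {a b} t t′ → decodePages a b t ≗ decodePages a b t′ → t ≡ t′
  decodePages-injective {a} {b} t t′ same = begin
    t                               ≡⟨ combine-remQuot {walks p (flip a) b} _ t ⟨
    uncurry combine (splitPages t)  ≡⟨ cong₂ combine first (finToFun-injective {walks p a b} {n′} others) ⟩
    uncurry combine (splitPages t′) ≡⟨ combine-remQuot {walks p (flip a) b} _ t′ ⟩
    t′                              ∎
    where
    open ≡-Reasoning
    first : proj₁ (splitPages t) ≡ proj₁ (splitPages t′)
    first = decodeWalk-injective p _ _ (same ∘ w zero)
    others : finToFun (proj₂ (splitPages t)) ≗ finToFun (proj₂ (splitPages t′))
    others i = decodeWalk-injective p _ _ (same ∘ w (suc i))

  decodeFrom-injective : ∀ {a} y y′ → decodeFrom a y ≗ decodeFrom a y′ → y ≡ y′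
  decodeFrom-injective (b , t) (b′ , t′) same with same v
  ... | refl = cong (b ,_) (decodePages-injective t t′ same)

  decodeΣ-injective : ∀ y y′ → decodeΣ y ≗ decodeΣ y′ → y ≡ y′
  decodeΣ-injective (a , r) (a′ , r′) same with same u
  ... | refl = cong (a ,_) (split≢-injective a _ (decodeFrom-injective _ _ same))

  decode-injective : ∀ i j → decode i ≗ decode j → i ≡ j
  decode-injective i j same = splitΣ-injective _ (decodeΣ-injective _ _ same)

  encode : (c : Vertex → Fin s) → PagesAreWalks c → Fin count
  encode c walks = joinΣ countFrom (c u , join≢ (c u) _ (c v) ends-distinct
    (combine (encodeWalk p first-page) (funToFin λ i → encodeWalk p (other-pages i))))
    where open PagesAreWalks walks

  decode-encode : ∀ c (walks : PagesAreWalks c) → decode (encode c walks) ≗ c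
  decode-encode c walks x = begin
    decode (encode c walks) x
      ≡⟨ cong (λ y → decodeΣ y x) (splitΣ-joinΣ countFrom _) ⟩
    decodeΣ (c u , join≢ (c u) _ (c v) ends-distinct t) x
      ≡⟨ cong (λ y → decodeFrom (c u) y x) (split≢-join≢ (c u) _ (c v) ends-distinct t) ⟩
    decodePages (c u) (c v) t x
      ≡⟨ decodePages-encode x ⟩
    c x
      ∎
    where
    open ≡-Reasoning
    open PagesAreWalks walks
    t : Fin (pagesCount (c u) (c v))
    t = combine (encodeWalk p first-page) (funToFin λ i → encodeWalk p (other-pages i))
    split-t : splitPages t ≡ (encodeWalk p first-page , funToFin λ i → encodeWalk p (other-pages i))
    split-t = remQuot-combine _ _
    decodePages-encode : decodePages (c u) (c v) t ≗ c
    decodePages-encode u = refl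
    decodePages-encode v = refl
    decodePages-encode (w zero j) = begin
      decodeWalk p _ _ (proj₁ (splitPages t)) j  ≡⟨ cong (λ y → decodeWalk p _ _ (proj₁ y) j) split-t ⟩
      decodeWalk p _ _ (encodeWalk p first-page) j ≡⟨ decodeWalk-encodeWalk p first-page j ⟩
      c (w zero j) ∎
    decodePages-encode (w (suc i) j) = begin
      decodeWalk p _ _ (finToFun (proj₂ (splitPages t)) i) j
        ≡⟨ cong (λ y → decodeWalk p _ _ (finToFun (proj₂ y) i) j) split-t ⟩
      decodeWalk p _ _ (finToFun (funToFin λ i → encodeWalk p (other-pages i)) i) j
        ≡⟨ cong (λ e → decodeWalk p _ _ e j) (finToFun-funToFin _ i) ⟩
      decodeWalk p _ _ (encodeWalk p (other-pages i)) j
        ≡⟨ decodeWalk-encodeWalk p (other-pages i) j ⟩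
      c (w (suc i) j) ∎

module _ {L} (flip : Fin (suc L) → Fin (suc L)) (flip-irreflexive : ∀ a → flip a ≢ a) (n′ p : ℕ) where
  open BookColorings flip n′ p

  countFrom-value : ∀ a → countFrom a ≡ openWalks L (suc p) * openWalks L p ℕ.^ n′
  countFrom-value a = begin
    countFrom a
      ≡⟨ sumOver≢-except a≢flip-a
           (cong₂ (λ x y → x * y ℕ.^ n′) (walks-≡ p (flip a)) (walks-≢ p a≢flip-a))
           (λ b a≢b b≢flip-a →
              cong₂ (λ x y → x * y ℕ.^ n′) (walks-≢ p (≢-sym b≢flip-a)) (walks-≢ p a≢b)) ⟩
    closedWalks L p * Dⁿ′ + pred L * (openWalks L p * Dⁿ′)
      ≡⟨ cong (_+_ (closedWalks L p * Dⁿ′)) (*-assoc (pred L) (openWalks L p) Dⁿ′) ⟨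
    closedWalks L p * Dⁿ′ + pred L * openWalks L p * Dⁿ′
      ≡⟨ *-distribʳ-+ Dⁿ′ (closedWalks L p) (pred L * openWalks L p) ⟨
    openWalks L (suc p) * Dⁿ′
      ∎
    where
    open ≡-Reasoning
    a≢flip-a : a ≢ flip a
    a≢flip-a = ≢-sym (flip-irreflexive a)
    Dⁿ′ : ℕ
    Dⁿ′ = openWalks L p ℕ.^ n′

  count-value : count ≡ suc L * (openWalks L (suc p) * openWalks L p ℕ.^ n′)
  count-value = sum-const countFrom-value

pos-^ : ∀ m n → + (m ℕ.^ n) ≡ (+ m) ^ n
pos-^ m zero    = refl
pos-^ m (suc n) = trans (ℤ.pos-* m _) (cong (+ m *ℤ_) (pos-^ m n))

^-distribʳ-* : ∀ x y n → (x *ℤ y) ^ n ≡ x ^ n *ℤ y ^ n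
^-distribʳ-* x y zero    = refl
^-distribʳ-* x y (suc n) = trans (cong (x *ℤ y *ℤ_) (^-distribʳ-* x y n)) (interchange x y (x ^ n) (y ^ n))
  where
  interchange : ∀ a b c d → a *ℤ b *ℤ (c *ℤ d) ≡ a *ℤ c *ℤ (b *ℤ d)
  interchange = solve-∀

-- For s = l + 2 colours these are s·γ_{q+2} and its closed-walk analogue, γ as in the paper.
openWalks-closedForm : ∀ l q →
  + suc (suc l) *ℤ + openWalks (suc l) q ≡ (+ suc (suc l) - 1ℤ) ^ suc q - -1ℤ ^ suc q
closedWalks-closedForm : ∀ l q →
  + suc (suc l) *ℤ + closedWalks (suc l) q ≡ (+ suc (suc l) - 1ℤ) ^ suc q +ℤ -1ℤ ^ suc q *ℤ (+ suc (suc l) - 1ℤ)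

openWalks-closedForm l zero = base (+ l)
  where
  base : ∀ x → (1ℤ +ℤ (1ℤ +ℤ x)) *ℤ 1ℤ ≡ (1ℤ +ℤ x) *ℤ 1ℤ - -1ℤ *ℤ 1ℤ
  base = solve-∀
openWalks-closedForm l (suc q) = begin
  s *ℤ + (closedWalks L q + l * openWalks L q)
    ≡⟨ cong (s *ℤ_) (trans (ℤ.pos-+ (closedWalks L q) _) (cong (+ closedWalks L q +ℤ_) (ℤ.pos-* l _))) ⟩
  s *ℤ (+ closedWalks L q +ℤ + l *ℤ + openWalks L q)
    ≡⟨ expand (+ l) (+ closedWalks L q) (+ openWalks L q) ⟩
  s *ℤ + closedWalks L q +ℤ + l *ℤ (s *ℤ + openWalks L q)
    ≡⟨ cong₂ (λ e d → e +ℤ + l *ℤ d) (closedWalks-closedForm l q) (openWalks-closedForm l q) ⟩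
  ((+ L) ^ suc q +ℤ -1ℤ ^ suc q *ℤ + L) +ℤ + l *ℤ ((+ L) ^ suc q - -1ℤ ^ suc q)
    ≡⟨ collect (+ l) ((+ L) ^ suc q) (-1ℤ ^ suc q) ⟩
  + L *ℤ (+ L) ^ suc q - -1ℤ *ℤ -1ℤ ^ suc q
    ∎
  where
  open ≡-Reasoning
  L : ℕ
  L = suc l
  s : ℤ
  s = + suc L
  expand : ∀ x e d →
    (1ℤ +ℤ (1ℤ +ℤ x)) *ℤ (e +ℤ x *ℤ d) ≡ (1ℤ +ℤ (1ℤ +ℤ x)) *ℤ e +ℤ x *ℤ ((1ℤ +ℤ (1ℤ +ℤ x)) *ℤ d)
  expand = solve-∀
  collect : ∀ x X Y → (X +ℤ Y *ℤ (1ℤ +ℤ x)) +ℤ x *ℤ (X - Y) ≡ (1ℤ +ℤ x) *ℤ X - -1ℤ *ℤ Y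
  collect = solve-∀

closedWalks-closedForm l zero = base (+ l)
  where
  base : ∀ x → (1ℤ +ℤ (1ℤ +ℤ x)) *ℤ + 0 ≡ (1ℤ +ℤ x) *ℤ 1ℤ +ℤ -1ℤ *ℤ 1ℤ *ℤ (1ℤ +ℤ x)
  base = solve-∀
closedWalks-closedForm l (suc q) = begin
  s *ℤ + (L * openWalks L q)
    ≡⟨ cong (s *ℤ_) (ℤ.pos-* L _) ⟩
  s *ℤ (+ L *ℤ + openWalks L q)
    ≡⟨ swap (+ L) s (+ openWalks L q) ⟩
  + L *ℤ (s *ℤ + openWalks L q)
    ≡⟨ cong (+ L *ℤ_) (openWalks-closedForm l q) ⟩
  + L *ℤ ((+ L) ^ suc q - -1ℤ ^ suc q)
    ≡⟨ collect (+ L) ((+ L) ^ suc q) (-1ℤ ^ suc q) ⟩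
  + L *ℤ (+ L) ^ suc q +ℤ (-1ℤ *ℤ -1ℤ ^ suc q) *ℤ + L
    ∎
  where
  open ≡-Reasoning
  L : ℕ
  L = suc l
  s : ℤ
  s = + suc L
  swap : ∀ x y z → y *ℤ (x *ℤ z) ≡ x *ℤ (y *ℤ z)
  swap = solve-∀
  collect : ∀ x X Y → x *ℤ (X - Y) ≡ x *ℤ X +ℤ (-1ℤ *ℤ Y) *ℤ x
  collect = solve-∀

bookCount-closedForm : ∀ {s L} → s ≡ suc L → 1 ≤ L → ∀ p n′ →
  + (suc L * (openWalks L (suc p) * openWalks L p ℕ.^ n′)) *ℤ (+ s) ^ suc n′
  ≡ + s *ℤ ((+ s - 1ℤ) ^ suc p - -1ℤ ^ suc p) ^ n′ *ℤ ((+ s - 1ℤ) ^ suc (suc p) - -1ℤ ^ suc (suc p))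
bookCount-closedForm {L = suc l} refl (s≤s z≤n) p n′ = begin
  + (S * (D₁ * D₀ ℕ.^ n′)) *ℤ s ^ suc n′
    ≡⟨ cong (_*ℤ s ^ suc n′) (trans (ℤ.pos-* S (D₁ * D₀ ℕ.^ n′)) (cong (s *ℤ_)
         (trans (ℤ.pos-* D₁ (D₀ ℕ.^ n′)) (cong (+ D₁ *ℤ_) (pos-^ D₀ n′))))) ⟩
  s *ℤ (+ D₁ *ℤ (+ D₀) ^ n′) *ℤ (s *ℤ s ^ n′)
    ≡⟨ rearrange s (+ D₁) ((+ D₀) ^ n′) (s ^ n′) ⟩
  s *ℤ (s ^ n′ *ℤ (+ D₀) ^ n′) *ℤ (s *ℤ + D₁)
    ≡⟨ cong (λ z → s *ℤ z *ℤ (s *ℤ + D₁)) (^-distribʳ-* s (+ D₀) n′) ⟨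
  s *ℤ (s *ℤ + D₀) ^ n′ *ℤ (s *ℤ + D₁)
    ≡⟨ cong₂ (λ x y → s *ℤ x ^ n′ *ℤ y) (openWalks-closedForm l p) (openWalks-closedForm l (suc p)) ⟩
  _ ∎
  where
  open ≡-Reasoning
  S D₀ D₁ : ℕ
  S = suc (suc l)
  D₀ = openWalks (suc l) p
  D₁ = openWalks (suc l) (suc p)
  s : ℤ
  s = + S
  rearrange : ∀ x d z y → x *ℤ (d *ℤ z) *ℤ (x *ℤ y) ≡ x *ℤ (y *ℤ z) *ℤ (x *ℤ d)
  rearrange = solve-∀

module _ (k n′ m′ : ℕ) where
  open SignedColors k
  open BookColorings oppositeIndex n′ (suc m′)

  Proper⇒PagesAreWalks : ∀ {c} → Proper c → PagesAreWalks (colorIndex ∘ c)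
  Proper⇒PagesAreWalks {c} proper = record
    { ends-distinct = positive e-uv
    ; first-page    = edges⇒IsWalk negative (λ j j′ eq → positive (e-mid zero j j′ eq))
                                            (λ j eq → positive (e-last zero j eq))
    ; other-pages   = λ i → edges⇒IsWalk (positive (e-first (suc i) zero refl λ ()))
                                         (λ j j′ eq → positive (e-mid (suc i) j j′ eq))
                                         (λ j eq → positive (e-last (suc i) j eq))
    }
    where
    positive : ∀ {x y} → BEdge (suc n′) (suc m′) x y pos → colorIndex (c x) ≢ colorIndex (c y)
    positive e same = proper _ _ pos e (cong colorValue (colorIndex-injective same))
    negative : oppositeIndex (colorIndex (c u)) ≢ colorIndex (c (w zero zero))
    negative same = proper _ _ neg (e-neg zero zero refl refl)
      (opposite≡⇒colorValue≡- (colorIndex-injective (trans (sym (oppositeIndex-colorIndex (c u))) same)))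

  PagesAreWalks⇒Proper : ∀ {c} → PagesAreWalks c → Proper (indexColor ∘ c)
  PagesAreWalks⇒Proper {c} walks = proper
    where
    open PagesAreWalks walks
    positive : ∀ {x y} → colorValue (indexColor (c x)) ≡ colorValue (indexColor (c y)) → c x ≡ c y
    positive = indexColor-injective ∘ colorValue-injective
    proper : Proper (indexColor ∘ c)
    proper _ _ _ e-uv                       = ends-distinct ∘ positive
    proper _ _ _ (e-first zero _ _ i≢0)     = ⊥-elim (i≢0 refl)
    proper _ _ _ (e-first (suc i) zero _ _) = proj₁ (other-pages i) ∘ positive
    proper _ _ _ (e-neg zero zero _ _) eq   =
      proj₁ first-page (trans (cong colorIndex (colorValue≡-⇒opposite≡ eq)) (colorIndex-indexColor _))
    proper _ _ _ (e-mid zero j j′ eq)       = IsWalk-adjacent (c ∘ w zero) first-page j j′ eq ∘ positive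
    proper _ _ _ (e-mid (suc i) j j′ eq)    = IsWalk-adjacent (c ∘ w (suc i)) (other-pages i) j j′ eq ∘ positive
    proper _ _ _ (e-last zero j eq)         = IsWalk-last (c ∘ w zero) first-page j eq ∘ positive
    proper _ _ _ (e-last (suc i) j eq)      = IsWalk-last (c ∘ w (suc i)) (other-pages i) j eq ∘ positive

  properColorings↔Fin : Inverse (ProperColorings k (3 + m′) (suc n′)) (setoid (Fin count))
  properColorings↔Fin =
    injective-section⇒Inverse (ProperColorings k (3 + m′) (suc n′)) from to from∘to from-injective
    where
    Carrier : Set
    Carrier = Setoid.Carrier (ProperColorings k (3 + m′) (suc n′))
    from : Fin count → Carrier
    from i = indexColor ∘ decode i , PagesAreWalks⇒Proper (decode-pagesAreWalks i)
    to : Carrier → Fin count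
    to (c , proper) = encode (colorIndex ∘ c) (Proper⇒PagesAreWalks proper)
    from∘to : ∀ c → proj₁ (from (to c)) ≗ proj₁ c
    from∘to (c , proper) x =
      trans (cong indexColor (decode-encode (colorIndex ∘ c) (Proper⇒PagesAreWalks proper) x))
            (indexColor-colorIndex (c x))
    from-injective : ∀ i j → proj₁ (from i) ≗ proj₁ (from j) → i ≡ j
    from-injective i j same = decode-injective i j (indexColor-injective ∘ same)

theorem4p5 : (m n k : ℕ) → 3 ≤ m → 1 ≤ n → 1 ≤ k →
    Σ ℕ (λ N →
      Inverse (ProperColorings k m n) (setoid (Fin N)) ×
      ((+ N) *ℤ ((+ (2 * k)) ^ n)
        ≡ (+ (2 * k)) *ℤ ((((+ (2 * k) - 1ℤ) ^ (m ∸ 1)) - (-1ℤ ^ (m ∸ 1))) ^ (n ∸ 1))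
            *ℤ (((+ (2 * k) - 1ℤ) ^ m) - (-1ℤ ^ m))))
theorem4p5 (suc (suc (suc m′))) (suc n′) (suc k′) (s≤s (s≤s (s≤s z≤n))) (s≤s z≤n) (s≤s z≤n) =
  count , properColorings↔Fin k n′ m′ ,
  trans (cong (λ N → + N *ℤ (+ (2 * k)) ^ suc n′)
              (count-value oppositeIndex oppositeIndex-irreflexive n′ (suc m′)))
        (bookCount-closedForm 2k≡k+k 1≤k′+k (suc m′) n′)
  where
  k : ℕ
  k = suc k′
  open SignedColors k
  open BookColorings oppositeIndex n′ (suc m′) using (count)
  2k≡k+k : 2 * k ≡ k + k
  2k≡k+k = cong (_+_ k) (ℕ.+-identityʳ k)
  1≤k′+k : 1 ≤ k′ + k
  1≤k′+k = ℕ.≤-trans (s≤s z≤n) (ℕ.m≤n+m k k′)
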